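{- Let $A$ be an irreducible $N\times N$ max-plus matrix, let $\gamma=\gamma(A)$, and let $B_1$, $\mu$ and the $\mu$-truncated unit vectors be as defined in the context. If $n\ge B_1$ is an integer such that $A^{\otimes(n+\gamma)}\otimes v=A^{\otimes n}\otimes v$ for every $\mu$-truncated unit vector $v$, then $A^{\otimes(n+\gamma)}=A^{\otimes n}$.
   Context: Entries are in $\mathbb{R}\cup\{ -\infty\}$; max-plus product $(A\otimes B)_{i,j}=\max_k(A_{i,k}+B_{k,j})$, $A^{\otimes 0}$ is $0$ on the diagonal and $-\infty$ elsewhere. $G(A)$ is the directed graph on $\{1,\dots,N\}$ with edge $(i,j)$ of weight $A_{i,j}$ iff $A_{i,j}\ne-\infty$; irreducible means $G(A)$ strongly connected; $G(A)$ is assumed to have at least one edge. Walk weights are sums of edge weights; a cycle is a closed walk with no nonempty closed proper subwalk. $\lambda(A)$ is the maximum average weight of a nonempty closed walk; critical closed walks attain it; critical edges lie on critical closed walks; $G_{\mathrm c}(A)$ is the subgraph formed by the critical edges and their endpoints. The cyclicity of a strongly connected graph is the gcd of its cycle lengths; the cyclicity of a non-strongly-connected graph is the lcm of the cyclicities of its strongly connected components; $\gamma(A)$ is the cyclicity of $G_{\mathrm c}(A)$. The exploration penalty $ep(H)$ of a strongly connected graph $H$ is the least $e$ such that for each node $i$ of $H$ and each $n\ge e$ divisible by the cyclicity of $H$ there is a closed walk in $H$ of length $n$ at $i$. $\hat\gamma$ and $\hat{ep}$ are the maximum cyclicity and maximum exploration penalty of the strongly connected components of $G_{\mathrm c}(A)$.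 $B_1=2(N-1)+\hat{ep}+ep(G(A))+\hat\gamma-1$. $\mu=\sup\{A^{\otimes n}_{i,h}-A^{\otimes n}_{i,j} : h,i,j\in\{1,\dots,N\},\ n\ge B_1,\ A^{\otimes n}_{i,j}\neq-\infty\}$, which is a real number. For $j\in\{1,\dots,N\}$, the $\mu$-truncated unit vector $v$ has $v_j=0$ and $v_h=-\mu$ for $h\ne j$. -}

module Defs where

open import Level using (0ℓ)
open import Data.Nat using (ℕ; zero; suc; _∸_; _≤_; _<_) renaming (_+_ to _+ℕ_; _*_ to _*ℕ_)
open import Data.Nat.Divisibility using (_∣_)
open import Data.Fin using (Fin; zero; suc; toℕ; inject₁; fromℕ; _≟_)
open import Data.Vec using (Vec; lookup)
open import Data.Product using (Σ; ∃; _×_; _,_)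
open import Data.Sum using (_⊎_; inj₁; inj₂)
open import Data.Unit using (⊤)
open import Data.Empty using (⊥)
open import Relation.Nullary using (¬_; yes; no)
open import Relation.Binary.PropositionalEquality using (_≡_)
open import Algebra.Structures using (IsCommutativeRing)
open import Relation.Binary.Structures using (IsTotalOrder)

-- The real numbers, axiomatised as a complete (Dedekind) ordered field.
-- Every model of this record is (classically) isomorphic to ℝ; the
-- theorem is stated for an arbitrary such model.

record RealField : Set₁ where
  infixl 6 _+ᵣ_
  infixl 7 _*ᵣ_
  infix 4 _≤ᵣ_
  field
    ℝ      : Set
    _+ᵣ_   : ℝ → ℝ → ℝ
    _*ᵣ_   : ℝ → ℝ → ℝ
    -ᵣ_    : ℝ → ℝ
    0ᵣ     : ℝ
    1ᵣ     : ℝ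
    _≤ᵣ_   : ℝ → ℝ → Set
    isCommutativeRing : IsCommutativeRing _≡_ _+ᵣ_ _*ᵣ_ -ᵣ_ 0ᵣ 1ᵣ
    0≢1    : ¬ (0ᵣ ≡ 1ᵣ)
    inverse : ∀ x → ¬ (x ≡ 0ᵣ) → Σ ℝ λ y → x *ᵣ y ≡ 1ᵣ
    isTotalOrder : IsTotalOrder _≡_ _≤ᵣ_
    +-mono-≤ : ∀ {x y} z → x ≤ᵣ y → x +ᵣ z ≤ᵣ y +ᵣ z
    *-nonneg : ∀ {x y} → 0ᵣ ≤ᵣ x → 0ᵣ ≤ᵣ y → 0ᵣ ≤ᵣ x *ᵣ y
    complete : (P : ℝ → Set) → ∃ P → (∃ λ b → ∀ x → P x → x ≤ᵣ b) →
               ∃ λ s → (∀ x → P x → x ≤ᵣ s) × (∀ b → (∀ x → P x → x ≤ᵣ b) → s ≤ᵣ b)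

  open IsTotalOrder isTotalOrder public using () renaming (total to ≤ᵣ-total)

  _-ᵣ_ : ℝ → ℝ → ℝ
  x -ᵣ y = x +ᵣ (-ᵣ y)

  IsSup : (ℝ → Set) → ℝ → Set
  IsSup P s = (∀ x → P x → x ≤ᵣ s) × (∀ b → (∀ x → P x → x ≤ᵣ b) → s ≤ᵣ b)

IsGcdOf : (ℕ → Set) → ℕ → Set
IsGcdOf P d = (∀ m → P m → d ∣ m) × (∀ d′ → (∀ m → P m → d′ ∣ m) → d′ ∣ d)

IsLcmOver : ∀ {N} → (Fin N → Set) → (Fin N → ℕ) → ℕ → Set
IsLcmOver P f g = (∀ i → P i → f i ∣ g) × (∀ m → (∀ i → P i → f i ∣ m) → g ∣ m)

IsMaxOver : ∀ {N} → (Fin N → Set) → (Fin N → ℕ) → ℕ → Set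
IsMaxOver P f m = (∀ i → P i → f i ≤ m) × ∃ λ i → P i × f i ≡ m

record Walk {N : ℕ} (E : Fin N → Fin N → Set) (l : ℕ) : Set where
  field
    nodes : Vec (Fin N) (suc l)
    edges : ∀ (k : Fin l) → E (lookup nodes (inject₁ k)) (lookup nodes (suc k))

  start : Fin N
  start = lookup nodes zero

  end : Fin N
  end = lookup nodes (fromℕ l)

open Walk public

module _ {N : ℕ} {E : Fin N → Fin N → Set} where

  Closed : ∀ {l} → Walk E l → Set
  Closed W = start W ≡ end W

  OnWalk : ∀ {l} → Walk E l → Fin N → Fin N → Set
  OnWalk {l} W i j = ∃ λ (k : Fin l) → lookup (nodes W) (inject₁ k) ≡ i × lookup (nodes W) (suc k) ≡ j

  -- cycle: nonempty closed walk with no nonempty closed proper subwalk,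
  -- i.e. the only repetition v_a = v_b (a < b) is a = 0, b = l.
  Cycle : ∀ {l} → Walk E l → Set
  Cycle {l} W = Closed W × 1 ≤ l ×
    (∀ (a b : Fin (suc l)) → toℕ a < toℕ b → lookup (nodes W) a ≡ lookup (nodes W) b →
       toℕ a ≡ 0 × toℕ b ≡ l)

Reach : ∀ {N} → (Fin N → Fin N → Set) → Fin N → Fin N → Set
Reach E i j = ∃ λ l → Σ (Walk E l) λ W → start W ≡ i × end W ≡ j

IsCyclicity : ∀ {N} → (Fin N → Fin N → Set) → ℕ → Set
IsCyclicity E σ = IsGcdOf (λ m → Σ (Walk E m) Cycle) σ

HasEP : ∀ {N} → (Fin N → Set) → (Fin N → Fin N → Set) → ℕ → ℕ → Set
HasEP V E σ e = ∀ i → V i → ∀ n → e ≤ n → σ ∣ n →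
  Σ (Walk E n) λ W → Closed W × start W ≡ i

IsEP : ∀ {N} → (Fin N → Set) → (Fin N → Fin N → Set) → ℕ → ℕ → Set
IsEP V E σ e = HasEP V E σ e × (∀ e′ → HasEP V E σ e′ → e ≤ e′)

B₁ : (N êp epA γ̂ : ℕ) → ℕ
B₁ N êp epA γ̂ = 2 *ℕ (N ∸ 1) +ℕ êp +ℕ epA +ℕ γ̂ ∸ 1

module MaxPlus (R : RealField) where
  open RealField R public

  data ℝmax : Set where
    -∞  : ℝmax
    fin : ℝ → ℝmax

  _⊕_ : ℝmax → ℝmax → ℝmax
  -∞ ⊕ y = y
  fin x ⊕ -∞ = fin x
  fin x ⊕ fin y with ≤ᵣ-total x y
  ... | inj₁ _ = fin y
  ... | inj₂ _ = fin x

  _⊙_ : ℝmax → ℝmax → ℝmax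
  -∞ ⊙ _ = -∞
  fin x ⊙ -∞ = -∞
  fin x ⊙ fin y = fin (x +ᵣ y)

  _≤ₘ_ : ℝmax → ℝmax → Set
  -∞ ≤ₘ _ = ⊤
  fin x ≤ₘ -∞ = ⊥
  fin x ≤ₘ fin y = x ≤ᵣ y

  _·_ : ℕ → ℝmax → ℝmax
  zero · x = fin 0ᵣ
  suc n · x = x ⊙ (n · x)

  ⨁ : ∀ {N} → (Fin N → ℝmax) → ℝmax
  ⨁ {zero} f = -∞
  ⨁ {suc N} f = f zero ⊕ ⨁ (λ k → f (suc k))

  Matrix : ℕ → Set
  Matrix N = Fin N → Fin N → ℝmax

  Vector : ℕ → Set
  Vector N = Fin N → ℝmax

  _⊗_ : ∀ {N} → Matrix N → Matrix N → Matrix N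
  (A ⊗ B) i j = ⨁ (λ k → A i k ⊙ B k j)

  _⊗ᵛ_ : ∀ {N} → Matrix N → Vector N → Vector N
  (A ⊗ᵛ v) i = ⨁ (λ k → A i k ⊙ v k)

  Id : ∀ {N} → Matrix N
  Id zero zero = fin 0ᵣ
  Id zero (suc j) = -∞
  Id (suc i) zero = -∞
  Id (suc i) (suc j) = Id i j

  _^_ : ∀ {N} → Matrix N → ℕ → Matrix N
  A ^ zero = Id
  A ^ suc n = (A ^ n) ⊗ A

  module _ {N : ℕ} (A : Matrix N) where

    GA : Fin N → Fin N → Set
    GA i j = ¬ (A i j ≡ -∞)

    Irreducible : Set
    Irreducible = ∀ i j → Reach GA i j

    HasEdge : Set
    HasEdge = ∃ λ i → ∃ λ j → GA i j

    weight : ∀ {l} → Walk GA l → ℝmax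
    weight {l} W = go l (λ k → A (lookup (nodes W) (inject₁ k)) (lookup (nodes W) (suc k)))
      where
        go : (m : ℕ) → (Fin m → ℝmax) → ℝmax
        go zero f = fin 0ᵣ
        go (suc m) f = f zero ⊙ go m (λ k → f (suc k))

    -- critical closed walk: nonempty, closed, with maximal average weight
    -- (weight W / l ≥ weight W′ / l′, written without division)
    Critical : ∀ {l} → Walk GA l → Set
    Critical {l} W = 1 ≤ l × Closed W ×
      (∀ l′ (W′ : Walk GA l′) → 1 ≤ l′ → Closed W′ → (l · weight W′) ≤ₘ (l′ · weight W))

    Ec : Fin N → Fin N → Set
    Ec i j = ∃ λ l → Σ (Walk GA l) λ W → Critical W × OnWalk W i j

    Vc : Fin N → Set
    Vc i = ∃ λ j → Ec i j ⊎ Ec j i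

    SCC : Fin N → Fin N → Set
    SCC i j = Vc j × Reach Ec i j × Reach Ec j i

    SCCEdge : Fin N → Fin N → Fin N → Set
    SCCEdge i j k = Ec j k × SCC i j × SCC i k

    MuSet : ℕ → ℝ → Set
    MuSet B x = ∃ λ n → B ≤ n × ∃ λ h → ∃ λ i → ∃ λ j → ∃ λ a → ∃ λ b →
      (A ^ n) i h ≡ fin a × (A ^ n) i j ≡ fin b × x ≡ a -ᵣ b

  truncUnit : ∀ {N} → ℝ → Fin N → Vector N
  truncUnit {N} μ j h with h ≟ j
  ... | yes _ = fin 0ᵣ
  ... | no _ = fin (-ᵣ μ)

module Submission where

-- For m ≥ B₁ the definition of μ makes the j-th term dominate (A^m ⊗ v_j)_i, so a finite entry
-- (A^m)_ij is read off the truncated column; hence the hypothesis forces agreement wherever both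
-- A^(n+γ)_ij and A^n_ij are finite, and it remains to show that the two powers have the same support.
-- An entry of A^m is finite iff G(A) has a walk of length m. Closed walks split into cycles, so their
-- lengths are divisible by the cyclicity σ of G(A), which divides the cyclicity of every critical
-- component and hence γ. A walk can be shortened below N by cutting loops and then padded by a closed
-- walk of any length ≥ ep(G(A)) divisible by σ; as B₁ ≥ N - 1 + ep(G(A)), walks of lengths n and
-- n + γ therefore connect the same pairs of nodes.

open import Defs
open import Data.Nat using (ℕ; zero; suc; _≤_; _<_; _+_; _*_; _∸_; z≤n; s≤s; s≤s⁻¹; _<?_; _≟_)
open import Data.Nat.Properties
open import Data.Nat.Divisibility using (_∣_; _∣0; ∣m∣n⇒∣m+n; ∣m+n∣m⇒∣n; ∣-trans; 0∣⇒≡0)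
open import Data.Nat.Induction using (<-rec)
open import Data.Fin using (Fin; toℕ; inject₁; fromℕ) renaming (zero to fzero; suc to fsuc)
import Data.Fin.Properties as Fin
open import Data.Vec using (_∷_; []; lookup; tabulate)
open import Data.Vec.Properties using (lookup∘tabulate)
open import Data.Product using (∃; _×_; _,_; proj₁; proj₂)
open import Data.Unit using (⊤; tt)
open import Data.Sum using (inj₁; inj₂)
open import Data.Empty using (⊥-elim)
open import Function using (_∘_)
open import Relation.Nullary using (¬_; Dec; yes; no)
open import Data.Nat.Tactic.RingSolver using (solve-∀)
open import Relation.Binary.PropositionalEquality
open import Algebra.Structures using (IsCommutativeRing)
open import Relation.Binary.Structures using (IsTotalOrder)

<⇒∃+suc : ∀ {a b} → a < b → ∃ λ c → b ≡ a + suc c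
<⇒∃+suc {a} a<b with m≤n⇒∃[o]m+o≡n a<b
... | c , refl = c , sym (+-suc a c)

loop<whole : ∀ a c r → suc c < a + suc c + suc r
loop<whole a c r = ≤-<-trans (m≤n+m (suc c) a) (m<m+n (a + suc c) (s≤s z≤n))

shortcut<whole : ∀ a c r → a + suc r < a + suc c + suc r
shortcut<whole a c r = +-monoˡ-< (suc r) (m<m+n a (s≤s z≤n))

pieces-sum : ∀ a c r → suc c + (a + suc r) ≡ a + suc c + suc r
pieces-sum = solve-∀

<⇒≤∸1 : ∀ {d n} → d < n → d ≤ n ∸ 1
<⇒≤∸1 (s≤s d≤n) = d≤n

module SeqWalks {N : ℕ} (E : Fin N → Fin N → Set) where

  -- Positions beyond m carry arbitrary nodes; this makes slicing and concatenation index-free.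
  record SeqWalk (m : ℕ) (i j : Fin N) : Set where
    field
      node   : ℕ → Fin N
      edge   : ∀ k → k < m → E (node k) (node (suc k))
      starts : node 0 ≡ i
      ends   : node m ≡ j

  open SeqWalk public

  ε : ∀ {i} → SeqWalk 0 i i
  ε {i} = record { node = λ _ → i ; edge = λ _ () ; starts = refl ; ends = refl }

  infixr 5 _◅_ _◅◅_

  _◅_ : ∀ {m i k j} → E i k → SeqWalk m k j → SeqWalk (suc m) i j
  _◅_ {i = i} e w = record
    { node   = λ { zero → i ; (suc x) → node w x }
    ; edge   = λ { zero _ → subst (E i) (sym (starts w)) e ; (suc x) (s≤s x<m) → edge w x x<m }
    ; starts = refl
    ; ends   = ends w
    }

  slice : ∀ {m i j} a c → a + c ≤ m → (w : SeqWalk m i j) → SeqWalk c (node w a) (node w (a + c))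
  slice a c a+c≤m w = record
    { node   = λ x → node w (a + x)
    ; edge   = λ x x<c → subst (λ y → E (node w (a + x)) (node w y)) (sym (+-suc a x))
                           (edge w (a + x) (≤-trans (≤-reflexive (sym (+-suc a x))) (≤-trans (+-monoʳ-≤ a x<c) a+c≤m)))
    ; starts = cong (node w) (+-identityʳ a)
    ; ends   = refl
    }

  take : ∀ {m i j} a → a ≤ m → (w : SeqWalk m i j) → SeqWalk a i (node w a)
  take a a≤m w = subst (λ x → SeqWalk a x _) (starts w) (slice 0 a a≤m w)

  drop : ∀ {n i j} a (w : SeqWalk (a + n) i j) → SeqWalk n (node w a) j
  drop {n} a w = subst (SeqWalk n _) (ends w) (slice a n ≤-refl w)

  _◅◅_ : ∀ {m n i k j} → SeqWalk m i k → SeqWalk n k j → SeqWalk (m + n) i j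
  _◅◅_ {zero}  w v = subst (λ x → SeqWalk _ x _) (trans (sym (ends w)) (starts w)) v
  _◅◅_ {suc m} w v = subst (λ x → E x (node w 1)) (starts w) (edge w 0 (s≤s z≤n)) ◅ (drop 1 w ◅◅ v)

  cutLoop : ∀ {m i j} a c r (w : SeqWalk m i j) → (a + c) + r ≡ m → node w a ≡ node w (a + c) →
            SeqWalk (a + r) i j × SeqWalk c (node w a) (node w a)
  cutLoop a c r w refl loop =
    take a (≤-trans (m≤m+n a c) (m≤m+n (a + c) r)) w ◅◅ subst (λ x → SeqWalk r x _) (sym loop) (drop (a + c) w) ,
    subst (SeqWalk c _) (sym loop) (slice a c (m≤m+n (a + c) r) w)

  fromWalk : ∀ {l} (W : Walk E l) → SeqWalk l (start W) (end W)
  fromWalk {zero}  record { nodes = _ ∷ [] } = ε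
  fromWalk {suc l} record { nodes = _ ∷ xs ; edges = es } =
    es fzero ◅ fromWalk record { nodes = xs ; edges = es ∘ fsuc }

  toWalk : ∀ {m i j} → SeqWalk m i j → Walk E m
  toWalk w = record
    { nodes = tabulate (node w ∘ toℕ)
    ; edges = λ k → subst₂ E (sym (lookup∘tabulate (node w ∘ toℕ) (inject₁ k))) (sym (lookup∘tabulate (node w ∘ toℕ) (fsuc k)))
                      (subst (λ x → E (node w x) (node w (suc (toℕ k)))) (sym (Fin.toℕ-inject₁ k))
                        (edge w (toℕ k) (Fin.toℕ<n k)))
    }

  Repeat : ∀ {m i j} → SeqWalk m i j → Set
  Repeat {m} w = ∃ λ b → b < m × ∃ λ a → a < b × node w a ≡ node w b

  cycle : ∀ {m i} (w : SeqWalk (suc m) i i) → ¬ Repeat w → Cycle (toWalk w)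
  cycle {m} w noRepeat = closed , s≤s z≤n , onlyEnds
    where
      lookup-node : ∀ a → lookup (nodes (toWalk w)) a ≡ node w (toℕ a)
      lookup-node = lookup∘tabulate (node w ∘ toℕ)
      node-end : node w 0 ≡ node w (suc m)
      node-end = trans (starts w) (sym (ends w))
      closed : start (toWalk w) ≡ end (toWalk w)
      closed = trans (lookup-node fzero)
                 (trans node-end (sym (trans (lookup-node (fromℕ (suc m))) (cong (node w) (Fin.toℕ-fromℕ (suc m))))))
      onlyEnds : ∀ (a b : Fin (suc (suc m))) → toℕ a < toℕ b → lookup (nodes (toWalk w)) a ≡ lookup (nodes (toWalk w)) b →
                 toℕ a ≡ 0 × toℕ b ≡ suc m
      onlyEnds a b a<b same with m≤n⇒m<n∨m≡n (s≤s⁻¹ (Fin.toℕ<n b))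
      ... | inj₁ b<m = ⊥-elim (noRepeat (toℕ b , b<m , toℕ a , a<b , trans (sym (lookup-node a)) (trans same (lookup-node b))))
      ... | inj₂ b≡m with toℕ a in a≡
      ...   | zero   = refl , b≡m
      -- the walk is closed, so a repetition at (a, m) is one at (0, a)
      ...   | suc a′ = ⊥-elim (noRepeat (suc a′ , <-≤-trans a<b (≤-reflexive b≡m) , 0 , s≤s z≤n , trans node-end
                 (trans (cong (node w) (sym b≡m)) (trans (sym (lookup-node b)) (trans (sym same) (trans (lookup-node a) (cong (node w) a≡)))))))

  repeat? : ∀ {m i j} (w : SeqWalk m i j) → Dec (Repeat w)
  repeat? {m} w = anyUpTo? (λ b → anyUpTo? (λ a → node w a Fin.≟ node w b) b) m

  closed-length-divisible : ∀ {σ} → IsCyclicity E σ → ∀ {m i} → SeqWalk m i i → σ ∣ m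
  closed-length-divisible {σ} cyc {m} = <-rec (λ m → ∀ {i} → SeqWalk m i i → σ ∣ m) step m
    where
      step : ∀ m → (∀ {k} → k < m → ∀ {i} → SeqWalk k i i → σ ∣ k) → ∀ {i} → SeqWalk m i i → σ ∣ m
      step zero    _   _ = σ ∣0
      step (suc m) rec w with repeat? w
      ... | no noRepeat = proj₁ cyc (suc m) (toWalk w , cycle w noRepeat)
      ... | yes (b , b<m , a , a<b , same) with <⇒∃+suc a<b | <⇒∃+suc b<m
      ...   | c , refl | r , m≡ with cutLoop a (suc c) (suc r) w (sym m≡) same
      ...     | shortcut , loop = subst (σ ∣_) (sym m≡) (subst (σ ∣_) (pieces-sum a c r)
                 (∣m∣n⇒∣m+n (rec (shorter (loop<whole a c r)) loop) (rec (shorter (shortcut<whole a c r)) shortcut)))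
        where
          shorter : ∀ {k} → k < a + suc c + suc r → k < suc m
          shorter {k} = subst (k <_) (sym m≡)

  shorten : ∀ {m i j} → SeqWalk m i j → ∃ λ d → d < N × SeqWalk d i j
  shorten {m} = <-rec (λ m → ∀ {i j} → SeqWalk m i j → ∃ λ d → d < N × SeqWalk d i j) step m
    where
      step : ∀ m → (∀ {k} → k < m → ∀ {i j} → SeqWalk k i j → ∃ λ d → d < N × SeqWalk d i j) →
             ∀ {i j} → SeqWalk m i j → ∃ λ d → d < N × SeqWalk d i j
      step m rec w with m <? N
      ... | yes m<N = m , m<N , w
      ... | no m≮N with Fin.pigeonhole (n<1+n N) (node w ∘ toℕ)
      ...   | x , y , x<y , same with <⇒∃+suc x<y | m≤n⇒∃[o]m+o≡n (≤-trans (s≤s⁻¹ (Fin.toℕ<n y)) (≮⇒≥ m≮N))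
      ...     | c , y≡ | r , m≡ = rec (subst (toℕ x + r <_) whole (+-monoˡ-< r (m<m+n (toℕ x) (s≤s z≤n)))) shortcut
        where
          whole : toℕ x + suc c + r ≡ m
          whole = trans (cong (_+ r) (sym y≡)) m≡
          shortcut : SeqWalk (toℕ x + r) _ _
          shortcut = proj₁ (cutLoop (toℕ x) (suc c) r w whole (trans same (cong (node w) y≡)))

mapWalk : ∀ {N} {E E′ : Fin N → Fin N → Set} → (∀ {i j} → E i j → E′ i j) → ∀ {l} → Walk E l → Walk E′ l
mapWalk f W = record { nodes = nodes W ; edges = f ∘ edges W }

cyclicity-∣-supergraph : ∀ {N} {E E′ : Fin N → Fin N → Set} {σ σ′} → (∀ {i j} → E i j → E′ i j) →
                         IsCyclicity E σ → IsCyclicity E′ σ′ → σ′ ∣ σ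
cyclicity-∣-supergraph E⊆E′ cyc cyc′ = proj₂ cyc _ λ m (W , isCycle) → proj₁ cyc′ m (mapWalk E⊆E′ W , isCycle)

module WalkLengths {N : ℕ} {E : Fin N → Fin N → Set} (strong : ∀ i j → Reach E i j)
  {σ ep : ℕ} (cyc : IsCyclicity E σ) (explore : HasEP (λ _ → ⊤) E σ ep) where

  open SeqWalks E

  private
    walkTo : ∀ i j → ∃ λ d → SeqWalk d i j
    walkTo i j with strong i j
    ... | d , W , refl , refl = d , fromWalk W

    closedWalk : ∀ {n} i → ep ≤ n → σ ∣ n → SeqWalk n i i
    closedWalk i ep≤n σ∣n with explore i tt _ ep≤n σ∣n
    ... | W , closed , refl = subst (SeqWalk _ _) (sym closed) (fromWalk W)

    -- Pad w by a closed walk of length n ∸ d; σ divides that length because it divides the round trip w ◅◅ back.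
    stretch : ∀ {d d′ n i j} → SeqWalk d i j → SeqWalk d′ j i → d + ep ≤ n → σ ∣ n + d′ → SeqWalk n i j
    stretch {d} {d′} {n} w back d+ep≤n σ∣n+d′ =
      subst (λ l → SeqWalk l _ _) (m∸n+n≡m d≤n) (closedWalk _ ep≤n∸d σ∣n∸d ◅◅ w)
      where
        d≤n : d ≤ n
        d≤n = ≤-trans (m≤m+n d ep) d+ep≤n
        ep≤n∸d : ep ≤ n ∸ d
        ep≤n∸d = subst (_≤ n ∸ d) (m+n∸m≡n d ep) (∸-monoˡ-≤ d d+ep≤n)
        regroup : ∀ x d d′ → (x + d) + d′ ≡ (d + d′) + x
        regroup = solve-∀
        σ∣n∸d : σ ∣ n ∸ d
        σ∣n∸d = ∣m+n∣m⇒∣n (subst (σ ∣_) (trans (cong (_+ d′) (sym (m∸n+n≡m d≤n))) (regroup (n ∸ d) d d′)) σ∣n+d′)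
                  (closed-length-divisible cyc (w ◅◅ back))

  walk-+-period : ∀ {m k i j} → σ ∣ k → (N ∸ 1) + ep ≤ m → SeqWalk m i j → SeqWalk (m + k) i j
  walk-+-period {m} {k} {i} {j} σ∣k bound w with shorten w | walkTo j i
  ... | d , d<N , short | d′ , back = stretch short back (≤-trans (+-monoˡ-≤ ep (<⇒≤∸1 d<N)) (≤-trans bound (m≤m+n m k)))
        (subst (σ ∣_) (regroup m k d′) (∣m∣n⇒∣m+n (closed-length-divisible cyc (w ◅◅ back)) σ∣k))
    where
      regroup : ∀ m k d′ → (m + d′) + k ≡ (m + k) + d′
      regroup = solve-∀

  walk-∸-period : ∀ {m k i j} → σ ∣ k → (N ∸ 1) + ep ≤ m → SeqWalk (m + k) i j → SeqWalk m i j
  walk-∸-period {m} {k} {i} {j} σ∣k bound w with shorten w | walkTo j i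
  ... | d , d<N , short | d′ , back = stretch short back (≤-trans (+-monoˡ-≤ ep (<⇒≤∸1 d<N)) bound)
        (∣m+n∣m⇒∣n (subst (σ ∣_) (regroup m k d′) (closed-length-divisible cyc (w ◅◅ back))) σ∣k)
    where
      regroup : ∀ m k d′ → (m + k) + d′ ≡ k + (m + d′)
      regroup = solve-∀

B₁-lower : ∀ N êp epA γ̂ → 1 ≤ γ̂ → (N ∸ 1) + epA ≤ B₁ N êp epA γ̂
B₁-lower N êp epA (suc g) _ =
  subst ((N ∸ 1) + epA ≤_) (trans (regroup (N ∸ 1) êp epA g) (cong (_∸ 1) (sym (+-suc _ g))))
    (m≤m+n ((N ∸ 1) + epA) _)
  where
    regroup : ∀ n êp epA g → (n + epA) + (n + êp + g) ≡ 2 * n + êp + epA + g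
    regroup = solve-∀

module MaxPlusLemmas (R : RealField) where
  open MaxPlus R renaming (+-mono-≤ to +ᵣ-monoˡ-≤)
  open IsTotalOrder isTotalOrder using () renaming (refl to ≤ᵣ-refl; trans to ≤ᵣ-trans; antisym to ≤ᵣ-antisym)
  private module ℝ = IsCommutativeRing isCommutativeRing

  x-y≤z⇒x-z≤y : ∀ {x y z} → x -ᵣ y ≤ᵣ z → x -ᵣ z ≤ᵣ y
  x-y≤z⇒x-z≤y {x} {y} {z} x-y≤z = subst₂ _≤ᵣ_ left right (+ᵣ-monoˡ-≤ (y -ᵣ z) x-y≤z)
    where
      open ≡-Reasoning
      left : (x -ᵣ y) +ᵣ (y -ᵣ z) ≡ x -ᵣ z
      left = begin
        (x +ᵣ -ᵣ y) +ᵣ (y +ᵣ -ᵣ z) ≡⟨ ℝ.+-assoc x (-ᵣ y) _ ⟩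
        x +ᵣ (-ᵣ y +ᵣ (y +ᵣ -ᵣ z)) ≡⟨ cong (x +ᵣ_) (sym (ℝ.+-assoc (-ᵣ y) y _)) ⟩
        x +ᵣ ((-ᵣ y +ᵣ y) +ᵣ -ᵣ z) ≡⟨ cong (λ t → x +ᵣ (t +ᵣ -ᵣ z)) (ℝ.-‿inverseˡ y) ⟩
        x +ᵣ (0ᵣ +ᵣ -ᵣ z)          ≡⟨ cong (x +ᵣ_) (ℝ.+-identityˡ (-ᵣ z)) ⟩
        x +ᵣ -ᵣ z                  ∎
      right : z +ᵣ (y -ᵣ z) ≡ y
      right = begin
        z +ᵣ (y +ᵣ -ᵣ z) ≡⟨ cong (z +ᵣ_) (ℝ.+-comm y (-ᵣ z)) ⟩
        z +ᵣ (-ᵣ z +ᵣ y) ≡⟨ sym (ℝ.+-assoc z (-ᵣ z) y) ⟩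
        (z +ᵣ -ᵣ z) +ᵣ y ≡⟨ cong (_+ᵣ y) (ℝ.-‿inverseʳ z) ⟩
        0ᵣ +ᵣ y          ≡⟨ ℝ.+-identityˡ y ⟩
        y                ∎

  ≤ₘ-refl : ∀ x → x ≤ₘ x
  ≤ₘ-refl -∞      = tt
  ≤ₘ-refl (fin x) = ≤ᵣ-refl

  ≤ₘ-trans : ∀ x y z → x ≤ₘ y → y ≤ₘ z → x ≤ₘ z
  ≤ₘ-trans -∞      _       _       _   _   = tt
  ≤ₘ-trans (fin x) (fin y) (fin z) x≤y y≤z = ≤ᵣ-trans x≤y y≤z

  ≤ₘ-antisym : ∀ {x y} → x ≤ₘ y → y ≤ₘ x → x ≡ y
  ≤ₘ-antisym { -∞}    { -∞}    _   _   = refl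
  ≤ₘ-antisym {fin x} {fin y} x≤y y≤x = cong fin (≤ᵣ-antisym x≤y y≤x)

  ⊕-lub : ∀ x y {z} → x ≤ₘ z → y ≤ₘ z → (x ⊕ y) ≤ₘ z
  ⊕-lub -∞      y       _   y≤z = y≤z
  ⊕-lub (fin x) -∞      x≤z _   = x≤z
  ⊕-lub (fin x) (fin y) x≤z y≤z with ≤ᵣ-total x y
  ... | inj₁ _ = y≤z
  ... | inj₂ _ = x≤z

  x≤x⊕y : ∀ x y → x ≤ₘ (x ⊕ y)
  x≤x⊕y -∞      y       = tt
  x≤x⊕y (fin x) -∞      = ≤ᵣ-refl
  x≤x⊕y (fin x) (fin y) with ≤ᵣ-total x y
  ... | inj₁ x≤y = x≤y
  ... | inj₂ _   = ≤ᵣ-refl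

  y≤x⊕y : ∀ x y → y ≤ₘ (x ⊕ y)
  y≤x⊕y -∞      y       = ≤ₘ-refl y
  y≤x⊕y (fin x) -∞      = tt
  y≤x⊕y (fin x) (fin y) with ≤ᵣ-total x y
  ... | inj₁ _   = ≤ᵣ-refl
  ... | inj₂ y≤x = y≤x

  ⨁-lub : ∀ {n} (g : Fin n → ℝmax) {z} → (∀ k → g k ≤ₘ z) → ⨁ g ≤ₘ z
  ⨁-lub {zero}  g _   = tt
  ⨁-lub {suc n} g {z} g≤z = ⊕-lub (g fzero) (⨁ (g ∘ fsuc)) {z} (g≤z fzero) (⨁-lub (g ∘ fsuc) (g≤z ∘ fsuc))

  ⨁-upper : ∀ {n} (g : Fin n → ℝmax) k → g k ≤ₘ ⨁ g
  ⨁-upper g fzero    = x≤x⊕y (g fzero) _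
  ⨁-upper g (fsuc k) = ≤ₘ-trans (g (fsuc k)) (⨁ (g ∘ fsuc)) (⨁ g) (⨁-upper (g ∘ fsuc) k) (y≤x⊕y (g fzero) (⨁ (g ∘ fsuc)))

  ⨁-attains : ∀ {n} (g : Fin n → ℝmax) {z} → (∀ k → g k ≤ₘ z) → ∀ k → g k ≡ z → ⨁ g ≡ z
  ⨁-attains g g≤z k refl = ≤ₘ-antisym (⨁-lub g g≤z) (⨁-upper g k)

  ⊕≡-∞ : ∀ x y → x ⊕ y ≡ -∞ → x ≡ -∞ × y ≡ -∞
  ⊕≡-∞ -∞      y       y≡-∞ = refl , y≡-∞
  ⊕≡-∞ (fin x) (fin y) eq   with ≤ᵣ-total x y
  ⊕≡-∞ (fin x) (fin y) ()   | inj₁ _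
  ⊕≡-∞ (fin x) (fin y) ()   | inj₂ _

  ⨁≡-∞ : ∀ {n} (g : Fin n → ℝmax) → ⨁ g ≡ -∞ → ∀ k → g k ≡ -∞
  ⨁≡-∞ g eq fzero    = proj₁ (⊕≡-∞ (g fzero) _ eq)
  ⨁≡-∞ g eq (fsuc k) = ⨁≡-∞ (g ∘ fsuc) (proj₂ (⊕≡-∞ (g fzero) _ eq)) k

  ⨁≢-∞ : ∀ {n} (g : Fin n → ℝmax) → ⨁ g ≢ -∞ → ∃ λ k → g k ≢ -∞
  ⨁≢-∞ {zero}  g ne = ⊥-elim (ne refl)
  ⨁≢-∞ {suc n} g ne with g fzero in eq
  ... | fin _ = fzero , λ g₀≡-∞ → case (trans (sym eq) g₀≡-∞)
    where
      case : ∀ {x} → fin x ≢ -∞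
      case ()
  ... | -∞ with ⨁≢-∞ (g ∘ fsuc) ne
  ...   | k , gₖ≢-∞ = fsuc k , gₖ≢-∞

  ⊙≢-∞ : ∀ x y → x ⊙ y ≢ -∞ → x ≢ -∞ × y ≢ -∞
  ⊙≢-∞ -∞      y       ne = ⊥-elim (ne refl)
  ⊙≢-∞ (fin x) -∞      ne = ⊥-elim (ne refl)
  ⊙≢-∞ (fin x) (fin y) _  = (λ ()) , (λ ())

  ≢-∞⇒⊙≢-∞ : ∀ x y → x ≢ -∞ → y ≢ -∞ → x ⊙ y ≢ -∞
  ≢-∞⇒⊙≢-∞ -∞      _       x≢-∞ _    = ⊥-elim (x≢-∞ refl)
  ≢-∞⇒⊙≢-∞ (fin x) -∞      _    y≢-∞ = ⊥-elim (y≢-∞ refl)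
  ≢-∞⇒⊙≢-∞ (fin x) (fin y) _    _    ()

  Id≢-∞⇒≡ : ∀ {N} {i j : Fin N} → Id i j ≢ -∞ → i ≡ j
  Id≢-∞⇒≡ {i = fzero}  {fzero}  _  = refl
  Id≢-∞⇒≡ {i = fzero}  {fsuc j} ne = ⊥-elim (ne refl)
  Id≢-∞⇒≡ {i = fsuc i} {fzero}  ne = ⊥-elim (ne refl)
  Id≢-∞⇒≡ {i = fsuc i} {fsuc j} ne = cong fsuc (Id≢-∞⇒≡ ne)

  Id-diagonal : ∀ {N} (i : Fin N) → Id i i ≢ -∞
  Id-diagonal fzero    ()
  Id-diagonal (fsuc i) = Id-diagonal i

  module _ {N : ℕ} (A : Matrix N) where
    open SeqWalks (GA A)

    power⇒walk : ∀ n {i j} → (A ^ n) i j ≢ -∞ → SeqWalk n i j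
    power⇒walk zero    {i} ne = subst (SeqWalk 0 i) (Id≢-∞⇒≡ ne) ε
    power⇒walk (suc n) {i} {j} ne with ⨁≢-∞ (λ k → (A ^ n) i k ⊙ A k j) ne
    ... | k , ne′ = subst (λ l → SeqWalk l i j) (+-comm n 1)
                      (power⇒walk n (proj₁ (⊙≢-∞ _ _ ne′)) ◅◅ proj₂ (⊙≢-∞ _ _ ne′) ◅ ε)

    walk⇒power : ∀ n {i j} → SeqWalk n i j → (A ^ n) i j ≢ -∞
    walk⇒power zero    {i} w = subst (λ j → Id i j ≢ -∞) (trans (sym (starts w)) (ends w)) (Id-diagonal i)
    walk⇒power (suc n) {i} {j} w ≡-∞ =
      ≢-∞⇒⊙≢-∞ _ _ (walk⇒power n (take n (n≤1+n n) w)) lastEdge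
        (⨁≡-∞ (λ k → (A ^ n) i k ⊙ A k j) ≡-∞ (node w n))
      where
        lastEdge : GA A (node w n) j
        lastEdge = subst (GA A (node w n)) (ends w) (edge w n ≤-refl)

    power-support-periodic : Irreducible A → ∀ {σ ep k m} → IsCyclicity (GA A) σ → HasEP (λ _ → ⊤) (GA A) σ ep →
                             σ ∣ k → (N ∸ 1) + ep ≤ m → ∀ i j →
                             ((A ^ (m + k)) i j ≢ -∞ → (A ^ m) i j ≢ -∞) × ((A ^ m) i j ≢ -∞ → (A ^ (m + k)) i j ≢ -∞)
    power-support-periodic irreducible {k = k} {m} cyc explore σ∣k bound i j =
      walk⇒power m ∘ walk-∸-period σ∣k bound ∘ power⇒walk (m + k) ,
      walk⇒power (m + k) ∘ walk-+-period σ∣k bound ∘ power⇒walk m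
      where open WalkLengths irreducible cyc explore

  truncUnit-diagonal : ∀ {N} μ (j : Fin N) → truncUnit μ j j ≡ fin 0ᵣ
  truncUnit-diagonal μ j with j Fin.≟ j
  ... | yes _  = refl
  ... | no j≢j = ⊥-elim (j≢j refl)

  ⊗ᵛ-truncUnit : ∀ {N} (M : Matrix N) μ i j {b} → M i j ≡ fin b →
                 (∀ k {a} → M i k ≡ fin a → a -ᵣ b ≤ᵣ μ) → (M ⊗ᵛ truncUnit μ j) i ≡ fin b
  ⊗ᵛ-truncUnit M μ i j {b} Mij≡b gap≤μ = ⨁-attains (λ k → M i k ⊙ truncUnit μ j k) term j attained
    where
      attained : M i j ⊙ truncUnit μ j j ≡ fin b
      attained rewrite Mij≡b | truncUnit-diagonal μ j = cong fin (ℝ.+-identityʳ b)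
      term : ∀ k → (M i k ⊙ truncUnit μ j k) ≤ₘ fin b
      term k with k Fin.≟ j
      ... | yes refl rewrite Mij≡b = subst (_≤ᵣ b) (sym (ℝ.+-identityʳ b)) ≤ᵣ-refl
      ... | no _ with M i k in Mik≡a
      ...   | -∞    = tt
      ...   | fin a = x-y≤z⇒x-z≤y (gap≤μ k Mik≡a)

  power-column : ∀ {N} (A : Matrix N) {B μ m i j b} → IsSup (MuSet A B) μ → B ≤ m → (A ^ m) i j ≡ fin b →
                 ((A ^ m) ⊗ᵛ truncUnit μ j) i ≡ fin b
  power-column A {m = m} {i} {j} sup B≤m Aᵐij≡b =
    ⊗ᵛ-truncUnit (A ^ m) _ i j Aᵐij≡b λ k Aᵐik≡a → proj₁ sup _ (m , B≤m , k , i , j , _ , _ , Aᵐik≡a , Aᵐij≡b , refl)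

  ≡-from-support : ∀ {x y} → (x ≢ -∞ → y ≢ -∞) → (y ≢ -∞ → x ≢ -∞) → (∀ {a b} → x ≡ fin a → y ≡ fin b → x ≡ y) → x ≡ y
  ≡-from-support { -∞}   { -∞}   _   _   _    = refl
  ≡-from-support { -∞}   {fin b} _   y⇒x _    = ⊥-elim (y⇒x (λ ()) refl)
  ≡-from-support {fin a} { -∞}   x⇒y _   _    = ⊥-elim (x⇒y (λ ()) refl)
  ≡-from-support {fin a} {fin b} _   _   same = same refl refl

  Ec⇒GA : ∀ {N} (A : Matrix N) {i j} → Ec A i j → GA A i j
  Ec⇒GA A (_ , W , _ , k , refl , refl) = edges W k

proposition6 : (R : RealField) → let open MaxPlus R in
    (N : ℕ) (A : Matrix N) → Irreducible A → HasEdge A →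
    (σ ε : Fin N → ℕ) →
    (∀ i → Vc A i → IsCyclicity (SCCEdge A i) (σ i) × IsEP (SCC A i) (SCCEdge A i) (σ i) (ε i)) →
    (γ : ℕ) → IsLcmOver (Vc A) σ γ →
    (γ̂ : ℕ) → IsMaxOver (Vc A) σ γ̂ →
    (êp : ℕ) → IsMaxOver (Vc A) ε êp →
    (σA epA : ℕ) → IsCyclicity (GA A) σA → IsEP (λ _ → ⊤) (GA A) σA epA →
    (μ : ℝ) → IsSup (MuSet A (B₁ N êp epA γ̂)) μ →
    (n : ℕ) → B₁ N êp epA γ̂ ≤ n →
    (∀ j i → ((A ^ (n + γ)) ⊗ᵛ truncUnit μ j) i ≡ ((A ^ n) ⊗ᵛ truncUnit μ j) i) →
    ∀ i j → (A ^ (n + γ)) i j ≡ (A ^ n) i j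
proposition6 R N A irreducible _ σ _ critical γ γ-lcm γ̂ γ̂-max êp _ σA epA cycA epA-ep μ μ-sup n B₁≤n agree i j
  with γ ≟ 0 | proj₂ γ̂-max
... | yes refl | _ rewrite +-identityʳ n = refl
... | no γ≢0 | i₀ , i₀-critical , σi₀≡γ̂ = ≡-from-support (proj₁ support) (proj₂ support) finite
  where
    open MaxPlus R
    open MaxPlusLemmas R
    σi₀∣γ : σ i₀ ∣ γ
    σi₀∣γ = proj₁ γ-lcm i₀ i₀-critical
    σA∣γ : σA ∣ γ
    σA∣γ = ∣-trans (cyclicity-∣-supergraph (Ec⇒GA A ∘ proj₁) (proj₁ (critical i₀ i₀-critical)) cycA) σi₀∣γ
    γ̂≥1 : 1 ≤ γ̂
    γ̂≥1 = n≢0⇒n>0 λ γ̂≡0 → γ≢0 (0∣⇒≡0 (subst (_∣ γ) (trans σi₀≡γ̂ γ̂≡0) σi₀∣γ))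
    support : ((A ^ (n + γ)) i j ≢ -∞ → (A ^ n) i j ≢ -∞) × ((A ^ n) i j ≢ -∞ → (A ^ (n + γ)) i j ≢ -∞)
    support = power-support-periodic A irreducible cycA (proj₁ epA-ep) σA∣γ (≤-trans (B₁-lower N êp epA γ̂ γ̂≥1) B₁≤n) i j
    finite : ∀ {a b} → (A ^ (n + γ)) i j ≡ fin a → (A ^ n) i j ≡ fin b → (A ^ (n + γ)) i j ≡ (A ^ n) i j
    finite Aⁿ⁺ᵞij≡a Aⁿij≡b = begin
      (A ^ (n + γ)) i j                         ≡⟨ Aⁿ⁺ᵞij≡a ⟩
      _                                         ≡⟨ power-column A μ-sup (≤-trans B₁≤n (m≤m+n n γ)) Aⁿ⁺ᵞij≡a ⟨
      ((A ^ (n + γ)) ⊗ᵛ truncUnit μ j) i        ≡⟨ agree j i ⟩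
      ((A ^ n) ⊗ᵛ truncUnit μ j) i              ≡⟨ power-column A μ-sup B₁≤n Aⁿij≡b ⟩
      _                                         ≡⟨ Aⁿij≡b ⟨
      (A ^ n) i j                               ∎
      where open ≡-Reasoning
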